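{- Let $G$ be a game structure of imperfect information and $H=\mathsf{Knw}(G)$ with state set $Q$ and transition relation $\Delta_H$. For all $q_1\in Q$ and all $\sigma\in\Sigma$, if $(q_1,\sigma,q_1')\in\Delta_H$, then for all $q_2'\in[q_1']_\approx$ there exists $q_2\in[q_1]_\approx$ such that $(q_2,\sigma,q_2')\in\Delta_H$.
   Context: Game structure $G=\langle L,l_0,\Sigma,\Delta,\mathcal{O},\gamma\rangle$: $L$ finite states, $\Sigma$ finite alphabet, $\Delta\subseteq L\times\Sigma\times L$ total, $\mathcal{O}$ finite observations, $\gamma:\mathcal{O}\to2^L\setminus\{\emptyset\}$ partitioning $L$; $\mathsf{Post}_\sigma(s)=\{\ell'\mid\exists\ell\in s:(\ell,\sigma,\ell')\in\Delta\}$. $H=\mathsf{Knw}(G)$ has states $Q=\{(s,\ell)\mid\exists o\in\mathcal{O}:s\subseteq\gamma(o),\ \ell\in s\}$ and $((s,\ell),\sigma,(s',\ell'))\in\Delta_H$ iff there is $o\in\mathcal{O}$ with $s'=\mathsf{Post}_\sigma(s)\cap\gamma(o)$ and $(\ell,\sigma,\ell')\in\Delta$ (with $(s,\ell),(s',\ell')\in Q$). Two states are equivalent, $(s,\ell)\approx(s',\ell')$, iff $s=s'$; $[q]_\approx$ is the equivalence class of $q$. -}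

module Defs where

open import Data.Nat using (ℕ)
open import Data.Fin using (Fin)
open import Data.Fin.Subset using (Subset; _∈_; _⊆_; _∩_; Nonempty)
open import Data.Bool using (Bool; true; false; T; _∧_)
open import Data.Vec using (tabulate; lookup)
open import Data.Product using (Σ; ∃; ∃-syntax; _×_; _,_)
open import Relation.Binary.PropositionalEquality using (_≡_)
open import Data.List using (allFin)
open import Data.Bool.ListAction using (any)

-- A game structure of imperfect information
-- G = ⟨ L , l₀ , Σ , Δ , O , γ ⟩ with L = Fin n, Σ = Fin m, O = Fin k.
-- Δ is given by its (decidable) characteristic function.
record GameStructure : Set where
  field
    n m k : ℕ
    l₀    : Fin n
    Δ     : Fin n → Fin m → Fin n → Bool
    γ     : Fin k → Subset n
    total : ∀ (ℓ : Fin n) (σ : Fin m) → ∃[ ℓ' ] T (Δ ℓ σ ℓ')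
    γ-nonempty : ∀ (o : Fin k) → Nonempty (γ o)
    γ-cover    : ∀ (ℓ : Fin n) → ∃[ o ] (ℓ ∈ γ o)
    γ-disjoint : ∀ (ℓ : Fin n) (o o' : Fin k) → ℓ ∈ γ o → ℓ ∈ γ o' → o ≡ o'

module Knw (G : GameStructure) where
  open GameStructure G

  Post : Fin m → Subset n → Subset n
  Post σ s = tabulate λ ℓ' → any (λ ℓ → lookup s ℓ ∧ Δ ℓ σ ℓ') (allFin n)

  IsState : Subset n × Fin n → Set
  IsState (s , ℓ) = (∃[ o ] (s ⊆ γ o)) × (ℓ ∈ s)

  Q : Set
  Q = Σ (Subset n × Fin n) IsState

  ⌊_⌋ : Q → Subset n × Fin n
  ⌊ p , _ ⌋ = p

  ΔH : Q → Fin m → Q → Set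
  ΔH ((s , ℓ) , _) σ ((s' , ℓ') , _) =
    (∃[ o ] (s' ≡ Post σ s ∩ γ o)) × T (Δ ℓ σ ℓ')

  _≈_ : Q → Q → Set
  ((s , _) , _) ≈ ((s' , _) , _) = s ≡ s'

-- Since s₂' = s₁' = Post_σ(s₁) ∩ γ(o), the location of q₂' has a σ-predecessor ℓ in s₁;
-- the state (s₁ , ℓ) is then ≈-equivalent to q₁ and steps to q₂' via the same observation o.
module Submission where

open import Defs
open import Data.Fin using (Fin)
open import Data.Fin.Subset using (Subset; _∈_; _∩_)
open import Data.Fin.Subset.Properties using (x∈p∩q⁻)
open import Data.Bool using (Bool; T)
open import Data.Bool.Properties using (T-≡; T-∧)
open import Data.Vec using (lookup; tabulate)
open import Data.Vec.Properties using (lookup∘tabulate; []=⇒lookup; lookup⇒[]=)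
open import Data.List using (allFin)
open import Data.List.Relation.Unary.Any using (satisfied)
open import Data.List.Relation.Unary.Any.Properties using (any⁻)
open import Data.Product using (∃-syntax; _×_; _,_; proj₁)
open import Function.Bundles using (Equivalence)
open import Relation.Binary.PropositionalEquality using (_≡_; refl; subst)

∈-tabulate⁻ : ∀ {n} (f : Fin n → Bool) {x : Fin n} → x ∈ tabulate f → T (f x)
∈-tabulate⁻ f {x} x∈ =
  Equivalence.from T-≡ (subst (_≡ _) (lookup∘tabulate f x) ([]=⇒lookup x∈))

module _ (G : GameStructure) where
  open GameStructure G
  open Knw G

  ∈-Post⁻ : ∀ {σ s ℓ'} → ℓ' ∈ Post σ s → ∃[ ℓ ] (ℓ ∈ s × T (Δ ℓ σ ℓ'))
  ∈-Post⁻ {σ} {s} {ℓ'} ℓ'∈Post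
    with ℓ , sℓ∧Δ ← satisfied (any⁻ _ (allFin n) (∈-tabulate⁻ _ ℓ'∈Post))
    with sℓ , Δℓσℓ' ← Equivalence.to T-∧ sℓ∧Δ
    = ℓ , lookup⇒[]= ℓ s (Equivalence.to T-≡ sℓ) , Δℓσℓ'

lemma4p5 : (G : GameStructure) → let open Knw G in
    ∀ (q₁ : Q) (σ : Fin (GameStructure.m G)) (q₁' : Q) → ΔH q₁ σ q₁' →
      ∀ (q₂' : Q) → q₂' ≈ q₁' →
        ∃[ q₂ ] ((q₂ ≈ q₁) × ΔH q₂ σ q₂')
lemma4p5 G ((s , _) , s-obs , _) σ _ ((o , s'≡) , _) ((s' , ℓ') , _ , ℓ'∈s') refl
  with ℓ , ℓ∈s , Δℓσℓ' ← ∈-Post⁻ G (proj₁ (x∈p∩q⁻ _ _ (subst (ℓ' ∈_) s'≡ ℓ'∈s')))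
  = ((s , ℓ) , s-obs , ℓ∈s) , refl , (o , s'≡) , Δℓσℓ'
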